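{- Let $P=\forall X\forall Y(((X\to Y)\to X)\to X)$, $Q=P\to\forall X\,X$, $N=\forall X(X\to(X\to X)\to X)$, $D=(Q\to P)\to N$, $B=\forall X(X\to X\to X)$, $E=\forall X((B\to D\to X)\to X\to X)$, $d_n=\lambda\alpha\,\underline{n}$ for $n\in\mathbf{N}$, and for $\lambda$-terms $u,v$ let $\ll u,v\gg=\lambda x\lambda y(x\,u\,v)$. For every closed normal $\lambda$-term $t$: $\vdash_{\mathcal{F}}t:E$ if and only if either $t=F$, or there exist $n\in\mathbf{N}$ and $b\in\{T,F\}$ with $t=\ll b,d_n\gg$.
   Context: $T=\lambda x\lambda y\,x$, $F=\lambda x\lambda y\,y$, $\underline{n}=\lambda x\lambda f(f^n\,x)$ (Church numeral). System $\mathcal{F}$ (Girard's second-order typed $\lambda$-calculus): types built from type variables and $\perp$ with $\to$ and $\forall X$; typing rules: variable, $\lambda$-abstraction, application, $\forall$-introduction (type variable not free in context), $\forall$-elimination. -}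

module Defs where

open import Data.Nat using (ℕ; zero; suc; _<ᵇ_; _≡ᵇ_; pred)
open import Data.Bool using (if_then_else_)
open import Data.Fin using (Fin; zero; suc)
open import Data.Vec using (Vec; []; _∷_; lookup; map)

-- Types of System F (type variables as de Bruijn indices, plus ⊥)

infixr 7 _⇒_

data Ty : Set where
  tv  : ℕ → Ty
  bot : Ty
  _⇒_ : Ty → Ty → Ty
  all : Ty → Ty          -- ∀X A, X bound as index 0

shift : ℕ → Ty → Ty
shift c (tv k)  = if k <ᵇ c then tv k else tv (suc k)
shift c bot     = bot
shift c (A ⇒ B) = shift c A ⇒ shift c B
shift c (all A) = all (shift (suc c) A)

substTy : ℕ → Ty → Ty → Ty
substTy j s (tv k)  = if k ≡ᵇ j then s else (if k <ᵇ j then tv k else tv (pred k))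
substTy j s bot     = bot
substTy j s (A ⇒ B) = substTy j s A ⇒ substTy j s B
substTy j s (all A) = all (substTy (suc j) (shift 0 s) A)

_[_] : Ty → Ty → Ty
A [ B ] = substTy 0 B A

-- Untyped λ-terms, well-scoped de Bruijn (Tm n : at most n free variables;
-- Tm 0 = closed terms; syntactic equality = α-equivalence)

data Tm (n : ℕ) : Set where
  var : Fin n → Tm n
  lam : Tm (suc n) → Tm n
  app : Tm n → Tm n → Tm n

ext : ∀ {n m} → (Fin n → Fin m) → Fin (suc n) → Fin (suc m)
ext ρ zero    = zero
ext ρ (suc i) = suc (ρ i)

rename : ∀ {n m} → (Fin n → Fin m) → Tm n → Tm m
rename ρ (var i)   = var (ρ i)
rename ρ (lam t)   = lam (rename (ext ρ) t)
rename ρ (app t u) = app (rename ρ t) (rename ρ u)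

wk : ∀ {n} → Tm n → Tm (suc n)
wk = rename suc

mutual
  data Ne {n : ℕ} : Tm n → Set where
    ne-var : (i : Fin n) → Ne (var i)
    ne-app : ∀ {t u} → Ne t → Nf u → Ne (app t u)

  data Nf {n : ℕ} : Tm n → Set where
    nf-ne  : ∀ {t} → Ne t → Nf t
    nf-lam : ∀ {t} → Nf t → Nf (lam t)

-- Curry-style typing in System F

infix 4 _⊢_∶_

data _⊢_∶_ {n : ℕ} (Γ : Vec Ty n) : Tm n → Ty → Set where
  ty-var : (i : Fin n) → Γ ⊢ var i ∶ lookup Γ i
  ty-lam : ∀ {A B t} → (A ∷ Γ) ⊢ t ∶ B → Γ ⊢ lam t ∶ A ⇒ B
  ty-app : ∀ {A B t u} → Γ ⊢ t ∶ A ⇒ B → Γ ⊢ u ∶ A → Γ ⊢ app t u ∶ B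
  -- ∀-introduction: shifting Γ makes the new variable 0 not free in Γ
  ty-gen : ∀ {A t} → map (shift 0) Γ ⊢ t ∶ A → Γ ⊢ t ∶ all A
  ty-ins : ∀ {A t} (B : Ty) → Γ ⊢ t ∶ all A → Γ ⊢ t ∶ A [ B ]

T F : Tm 0
T = lam (lam (var (suc zero)))
F = lam (lam (var zero))

-- f^k x  with f = var 0, x = var 1
iterBody : ∀ {m} → ℕ → Tm (suc (suc m))
iterBody zero    = var (suc zero)
iterBody (suc k) = app (var zero) (iterBody k)

church : ∀ {m} → ℕ → Tm m
church k = lam (lam (iterBody k))

d : ℕ → Tm 0
d k = lam (church k)

⟪_,_⟫ : Tm 0 → Tm 0 → Tm 0
⟪ u , v ⟫ = lam (lam (app (app (var (suc zero)) (wk (wk u))) (wk (wk v))))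

Pty Qty Nty Dty Bty Ety : Ty
Pty = all (all (((tv 1 ⇒ tv 0) ⇒ tv 1) ⇒ tv 1))   -- ∀X∀Y(((X→Y)→X)→X)
Qty = Pty ⇒ all (tv 0)
Nty = all (tv 0 ⇒ (tv 0 ⇒ tv 0) ⇒ tv 0)
Dty = (Qty ⇒ Pty) ⇒ Nty
Bty = all (tv 0 ⇒ tv 0 ⇒ tv 0)
Ety = all ((Bty ⇒ Dty ⇒ tv 0) ⇒ tv 0 ⇒ tv 0)

module Submission where

-- A closed normal inhabitant of E is λx λy followed by a normal term of type X, and the
-- arguments of x must be normal inhabitants of B and D in turn. In each context that arises,
-- a neutral term is a head variable applied to a spine of arguments, and every type it has is
-- the codomain reached by the spine under vacuous quantifiers: no ∀ is ever instantiated.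
-- The only codomain that is a ∀-type is P in z : Q ⇒ P, and it is never reached, because an
-- argument of type Q = P ⇒ ∀X X would contradict the two-valued model in which every type
-- variable is true (P, Peirce's law, is true there and ∀X X false). So the shape of each
-- normal subterm is fixed by its head variable and the length of its spine, which leaves
-- exactly F and ⟪ b , d n ⟫ with b ∈ {T, F} and d n = λz λa λf fⁿ a.

open import Defs
open import Data.Nat using (ℕ; zero; suc; _+_; pred; _<ᵇ_; _≡ᵇ_; _<_; _≤_; _<?_; z≤n; s≤s)
open import Data.Nat.Properties using (<-cmp; <⇒≢; ≮⇒≥; ≤-trans; n≤1+n; +-suc; +-identityʳ)
open import Data.Bool using (Bool; true; false; not; _∧_; _∨_; if_then_else_) renaming (T to IsTrue)
open import Data.Bool.Properties using (T-≡)
open import Function.Bundles using (Equivalence; _⇔_; mk⇔)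
open import Data.Unit using (⊤; tt)
open import Data.Sum using (_⊎_; inj₁; inj₂)
open import Data.Vec.Relation.Unary.All using (All; []; _∷_)
open import Data.Vec.Relation.Unary.All.Properties using (lookup⁺)
open import Data.Fin using (Fin; zero; suc)
open import Data.Vec using (Vec; []; _∷_; lookup; map)
open import Data.Vec.Properties using (lookup-map; map-∘; map-cong; map-id)
open import Data.Product using (Σ; _×_; _,_)
open import Data.Empty using (⊥; ⊥-elim)
open import Relation.Binary using (tri<; tri≈; tri>)
open import Relation.Binary.PropositionalEquality using (_≡_; _≢_; module ≡-Reasoning; ≢-sym; refl; sym; trans; cong; cong₂; subst)
open import Relation.Nullary using (yes; no)
open import Relation.Nullary.Negation using (contradiction)

<ᵇ-true : ∀ {k c} → k < c → (k <ᵇ c) ≡ true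
<ᵇ-true {zero} {suc c} _ = refl
<ᵇ-true {suc k} {suc c} (s≤s k<c) = <ᵇ-true k<c

<ᵇ-false : ∀ {k c} → c ≤ k → (k <ᵇ c) ≡ false
<ᵇ-false {k} {zero} _ = refl
<ᵇ-false {suc k} {suc c} (s≤s c≤k) = <ᵇ-false c≤k

≡ᵇ-refl : ∀ k → (k ≡ᵇ k) ≡ true
≡ᵇ-refl zero = refl
≡ᵇ-refl (suc k) = ≡ᵇ-refl k

≡ᵇ-false : ∀ {k j} → k ≢ j → (k ≡ᵇ j) ≡ false
≡ᵇ-false {zero} {zero} k≢j = contradiction refl k≢j
≡ᵇ-false {zero} {suc j} _ = refl
≡ᵇ-false {suc k} {zero} _ = refl
≡ᵇ-false {suc k} {suc j} k≢j = ≡ᵇ-false (λ k≡j → k≢j (cong suc k≡j))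

data VarPosition (j : ℕ) : ℕ → Set where
  below : ∀ {k} → k < j → VarPosition j k
  at    : VarPosition j j
  above : ∀ {k} → j ≤ k → VarPosition j (suc k)

varPosition : ∀ j k → VarPosition j k
varPosition j k with <-cmp k j
varPosition j k       | tri< k<j _ _ = below k<j
varPosition j k       | tri≈ _ refl _ = at
varPosition j (suc k) | tri> _ _ (s≤s j≤k) = above j≤k

shift-tv-< : ∀ {c k} → k < c → shift c (tv k) ≡ tv k
shift-tv-< k<c rewrite <ᵇ-true k<c = refl

shift-tv-≥ : ∀ {c k} → c ≤ k → shift c (tv k) ≡ tv (suc k)
shift-tv-≥ c≤k rewrite <ᵇ-false c≤k = refl

substTy-tv-< : ∀ {j k} B → k < j → substTy j B (tv k) ≡ tv k
substTy-tv-< B k<j rewrite ≡ᵇ-false (<⇒≢ k<j) | <ᵇ-true k<j = refl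

substTy-tv-≡ : ∀ j B → substTy j B (tv j) ≡ B
substTy-tv-≡ j B rewrite ≡ᵇ-refl j = refl

substTy-tv-> : ∀ {j k} B → j ≤ k → substTy j B (tv (suc k)) ≡ tv k
substTy-tv-> B j≤k rewrite ≡ᵇ-false (≢-sym (<⇒≢ (s≤s j≤k))) | <ᵇ-false (≤-trans j≤k (n≤1+n _)) = refl

substTy-shift : ∀ c B A → substTy c B (shift c A) ≡ A
substTy-shift c B (tv k) with k <? c
... | yes k<c rewrite shift-tv-< k<c = substTy-tv-< B k<c
... | no  k≮c rewrite shift-tv-≥ (≮⇒≥ k≮c) = substTy-tv-> B (≮⇒≥ k≮c)
substTy-shift c B bot     = refl
substTy-shift c B (A ⇒ C) = cong₂ _⇒_ (substTy-shift c B A) (substTy-shift c B C)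
substTy-shift c B (all A) = cong all (substTy-shift (suc c) (shift 0 B) A)

shift-shift : ∀ {i c} → i ≤ c → ∀ A → shift i (shift c A) ≡ shift (suc c) (shift i A)
shift-shift {i} {c} i≤c (tv k) with k <? i | k <? c
... | yes k<i | _ rewrite shift-tv-< (≤-trans k<i i≤c) | shift-tv-< k<i
                        | shift-tv-< (≤-trans k<i (≤-trans i≤c (n≤1+n c))) = refl
... | no k≮i | yes k<c rewrite shift-tv-< k<c | shift-tv-≥ (≮⇒≥ k≮i) | shift-tv-< (s≤s k<c) = refl
... | no k≮i | no k≮c rewrite shift-tv-≥ (≮⇒≥ k≮c) | shift-tv-≥ (≮⇒≥ k≮i)
                           | shift-tv-≥ (≤-trans (≮⇒≥ k≮i) (n≤1+n k)) | shift-tv-≥ (s≤s (≮⇒≥ k≮c)) = refl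
shift-shift i≤c bot     = refl
shift-shift i≤c (A ⇒ B) = cong₂ _⇒_ (shift-shift i≤c A) (shift-shift i≤c B)
shift-shift i≤c (all A) = cong all (shift-shift (s≤s i≤c) A)

substTy-shift-comm : ∀ {c j} → c ≤ j → ∀ B A → substTy (suc j) (shift c B) (shift c A) ≡ shift c (substTy j B A)
substTy-shift-comm {c} {j} c≤j B (tv k) with k <? c
... | yes k<c rewrite shift-tv-< k<c | substTy-tv-< (shift c B) (≤-trans k<c (≤-trans c≤j (n≤1+n j)))
                    | substTy-tv-< B (≤-trans k<c c≤j) | shift-tv-< k<c = refl
... | no k≮c rewrite shift-tv-≥ (≮⇒≥ k≮c) with varPosition j k
...   | below k<j rewrite substTy-tv-< (shift c B) (s≤s k<j) | substTy-tv-< B k<j | shift-tv-≥ (≮⇒≥ k≮c) = refl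
...   | at rewrite substTy-tv-≡ (suc j) (shift c B) | substTy-tv-≡ j B = refl
...   | above j≤k rewrite substTy-tv-> (shift c B) (s≤s j≤k) | substTy-tv-> B j≤k
                        | shift-tv-≥ (≤-trans c≤j j≤k) = refl
substTy-shift-comm c≤j B bot     = refl
substTy-shift-comm c≤j B (A ⇒ C) = cong₂ _⇒_ (substTy-shift-comm c≤j B A) (substTy-shift-comm c≤j B C)
substTy-shift-comm {c} {j} c≤j B (all A) =
  cong all (trans (cong (λ B′ → substTy (suc (suc j)) B′ (shift (suc c) A)) (shift-shift z≤n B))
                  (substTy-shift-comm (s≤s c≤j) (shift 0 B) A))

substTy-substTy : ∀ {i j} → i ≤ j → ∀ B C A →
  substTy j B (substTy i C A) ≡ substTy i (substTy j B C) (substTy (suc j) (shift i B) A)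
substTy-substTy {i} {j} i≤j B C (tv k) with varPosition i k
... | below k<i rewrite substTy-tv-< C k<i | substTy-tv-< B (≤-trans k<i i≤j)
                      | substTy-tv-< (shift i B) (≤-trans k<i (≤-trans i≤j (n≤1+n j)))
                      | substTy-tv-< (substTy j B C) k<i = refl
... | at rewrite substTy-tv-≡ i C | substTy-tv-< (shift i B) (s≤s i≤j) | substTy-tv-≡ i (substTy j B C) = refl
... | above {k} i≤k rewrite substTy-tv-> C i≤k with varPosition j k
...   | below k<j rewrite substTy-tv-< B k<j | substTy-tv-< (shift i B) (s≤s k<j)
                        | substTy-tv-> (substTy j B C) i≤k = refl
...   | at rewrite substTy-tv-≡ j B | substTy-tv-≡ (suc j) (shift i B) = sym (substTy-shift i _ B)
...   | above j≤k′ rewrite substTy-tv-> B j≤k′ | substTy-tv-> (shift i B) (s≤s j≤k′)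
                         | substTy-tv-> (substTy j B C) (≤-trans i≤j j≤k′) = refl
substTy-substTy i≤j B C bot     = refl
substTy-substTy i≤j B C (A ⇒ A′) = cong₂ _⇒_ (substTy-substTy i≤j B C A) (substTy-substTy i≤j B C A′)
substTy-substTy {i} {j} i≤j B C (all A) = cong all (trans
  (substTy-substTy (s≤s i≤j) (shift 0 B) (shift 0 C) A)
  (cong₂ (λ C′ B′ → substTy (suc i) C′ (substTy (suc (suc j)) B′ A))
         (substTy-shift-comm z≤n B C) (sym (shift-shift z≤n B))))

⊢-substTy : ∀ {n} {Γ : Vec Ty n} {t A} j B → Γ ⊢ t ∶ A → map (substTy j B) Γ ⊢ t ∶ substTy j B A
⊢-substTy {Γ = Γ} j B (ty-var i) = subst (map (substTy j B) Γ ⊢ var i ∶_) (lookup-map i (substTy j B) Γ) (ty-var i)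
⊢-substTy j B (ty-lam ⊢t)   = ty-lam (⊢-substTy j B ⊢t)
⊢-substTy j B (ty-app ⊢t ⊢u) = ty-app (⊢-substTy j B ⊢t) (⊢-substTy j B ⊢u)
⊢-substTy {Γ = Γ} {t} j B (ty-gen {A} ⊢t) =
  ty-gen (subst (λ Δ → Δ ⊢ t ∶ substTy (suc j) (shift 0 B) A) context-comm (⊢-substTy (suc j) (shift 0 B) ⊢t))
  where
  context-comm : map (substTy (suc j) (shift 0 B)) (map (shift 0) Γ) ≡ map (shift 0) (map (substTy j B) Γ)
  context-comm = trans (sym (map-∘ _ _ Γ)) (trans (map-cong (substTy-shift-comm z≤n B) Γ) (map-∘ _ _ Γ))
⊢-substTy {Γ = Γ} {t} j B (ty-ins {A} C ⊢t) =
  subst (map (substTy j B) Γ ⊢ t ∶_) (sym (substTy-substTy z≤n B C A)) (ty-ins (substTy j B C) (⊢-substTy j B ⊢t))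

⊢-unshift : ∀ {n} {Γ : Vec Ty n} {t A} → map (shift 0) Γ ⊢ t ∶ shift 0 A → Γ ⊢ t ∶ A
⊢-unshift {Γ = Γ} {t} {A} ⊢t = subst (Γ ⊢ t ∶_) (substTy-shift 0 (tv 0) A) (ty-ins (tv 0) (ty-gen ⊢t))

allN : ℕ → Ty → Ty
allN zero    A = A
allN (suc m) A = all (allN m A)

shiftN : ℕ → Ty → Ty
shiftN zero    A = A
shiftN (suc m) A = shift 0 (shiftN m A)

-- Shifts on the inside, so that shiftCtx (suc m) Γ is literally the context below one more ty-gen.
shiftCtx : ∀ {n} → ℕ → Vec Ty n → Vec Ty n
shiftCtx zero    Γ = Γ
shiftCtx (suc m) Γ = shiftCtx m (map (shift 0) Γ)

shiftN-shift : ∀ m A → shiftN m (shift 0 A) ≡ shift 0 (shiftN m A)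
shiftN-shift zero    A = refl
shiftN-shift (suc m) A = cong (shift 0) (shiftN-shift m A)

shiftCtx-map : ∀ {n} m (Γ : Vec Ty n) → shiftCtx m Γ ≡ map (shiftN m) Γ
shiftCtx-map zero    Γ = sym (map-id Γ)
shiftCtx-map (suc m) Γ = trans (shiftCtx-map m (map (shift 0) Γ)) (trans (sym (map-∘ _ _ Γ)) (map-cong (shiftN-shift m) Γ))

shift-shiftN : ∀ m A → shift 0 (shiftN m A) ≡ shift m (shiftN m A)
shift-shiftN zero    A = refl
shift-shiftN (suc m) A = trans (cong (shift 0) (shift-shiftN m A)) (shift-shift z≤n (shiftN m A))

substTy-shiftN : ∀ m C A → substTy m C (shiftN (suc m) A) ≡ shiftN m A
substTy-shiftN m C A = trans (cong (substTy m C) (shift-shiftN m A)) (substTy-shift m C (shiftN m A))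

substTy-allN : ∀ m j B A → substTy j B (allN m A) ≡ allN m (substTy (m + j) (shiftN m B) A)
substTy-allN zero    j B A = refl
substTy-allN (suc m) j B A = cong all (trans (substTy-allN m (suc j) (shift 0 B) A)
  (cong₂ (λ k B′ → allN m (substTy k B′ A)) (+-suc m j) (shiftN-shift m B)))

allN-[] : ∀ m B A → allN m A [ B ] ≡ allN m (substTy m (shiftN m B) A)
allN-[] m B A = trans (substTy-allN m 0 B A) (cong (λ k → allN m (substTy k (shiftN m B) A)) (+-identityʳ m))

substTy-shiftCtx : ∀ {n} m C (Γ : Vec Ty n) → map (substTy m C) (shiftCtx (suc m) Γ) ≡ shiftCtx m Γ
substTy-shiftCtx m C Γ = begin
  map (substTy m C) (shiftCtx (suc m) Γ)   ≡⟨ cong (map (substTy m C)) (shiftCtx-map (suc m) Γ) ⟩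
  map (substTy m C) (map (shiftN (suc m)) Γ) ≡⟨ sym (map-∘ _ _ Γ) ⟩
  map (λ A → substTy m C (shiftN (suc m) A)) Γ ≡⟨ map-cong (substTy-shiftN m C) Γ ⟩
  map (shiftN m) Γ                          ≡⟨ sym (shiftCtx-map m Γ) ⟩
  shiftCtx m Γ                              ∎
  where open ≡-Reasoning

⊢lam-inv : ∀ {n} {Γ : Vec Ty n} {s Y} → Γ ⊢ lam s ∶ Y →
  Σ ℕ λ m → Σ Ty λ A → Σ Ty λ B → Y ≡ allN m (A ⇒ B) × (A ∷ shiftCtx m Γ) ⊢ s ∶ B
⊢lam-inv (ty-lam ⊢s) = 0 , _ , _ , refl , ⊢s
⊢lam-inv (ty-gen ⊢t) with ⊢lam-inv ⊢t
... | m , A , B , refl , ⊢s = suc m , A , B , refl , ⊢s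
⊢lam-inv {Γ = Γ} {s} (ty-ins C ⊢t) with ⊢lam-inv ⊢t
... | suc m , A , B , refl , ⊢s =
  m , substTy m C′ A , substTy m C′ B , allN-[] m C (A ⇒ B) ,
  subst (λ Δ → (substTy m C′ A ∷ Δ) ⊢ s ∶ substTy m C′ B) (substTy-shiftCtx m C′ Γ) (⊢-substTy m C′ ⊢s)
  where C′ = shiftN m C

⊢lam-⇒-inv : ∀ {n} {Γ : Vec Ty n} {s A B} → Γ ⊢ lam s ∶ A ⇒ B → (A ∷ Γ) ⊢ s ∶ B
⊢lam-⇒-inv ⊢t with ⊢lam-inv ⊢t
... | zero , _ , _ , refl , ⊢s = ⊢s

⊢lam-∀⇒-inv : ∀ {n} {Γ : Vec Ty n} {s A B} → Γ ⊢ lam s ∶ all (A ⇒ B) → (A ∷ map (shift 0) Γ) ⊢ s ∶ B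
⊢lam-∀⇒-inv ⊢t with ⊢lam-inv ⊢t
... | suc zero , _ , _ , refl , ⊢s = ⊢s

⊢lam-tv : ∀ {n} {Γ : Vec Ty n} {s k} → Γ ⊢ lam s ∶ tv k → ⊥
⊢lam-tv ⊢t with ⊢lam-inv ⊢t
... | zero , _ , _ , () , _

Valuation : Set
Valuation = ℕ → Bool

_◂_ : Bool → Valuation → Valuation
(b ◂ ρ) zero    = b
(b ◂ ρ) (suc k) = ρ k

⟦_⟧ : Ty → Valuation → Bool
⟦ tv k ⟧  ρ = ρ k
⟦ bot ⟧   ρ = false
⟦ A ⇒ B ⟧ ρ = not (⟦ A ⟧ ρ) ∨ ⟦ B ⟧ ρ
⟦ all A ⟧ ρ = ⟦ A ⟧ (true ◂ ρ) ∧ ⟦ A ⟧ (false ◂ ρ)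

⟦⟧-cong : ∀ A {ρ ρ′} → (∀ k → ρ k ≡ ρ′ k) → ⟦ A ⟧ ρ ≡ ⟦ A ⟧ ρ′
⟦⟧-cong (tv k)  ρ≗ρ′ = ρ≗ρ′ k
⟦⟧-cong bot     ρ≗ρ′ = refl
⟦⟧-cong (A ⇒ B) ρ≗ρ′ = cong₂ (λ a b → not a ∨ b) (⟦⟧-cong A ρ≗ρ′) (⟦⟧-cong B ρ≗ρ′)
⟦⟧-cong (all A) {ρ} {ρ′} ρ≗ρ′ = cong₂ _∧_ (⟦⟧-cong A (◂-cong true)) (⟦⟧-cong A (◂-cong false))
  where
  ◂-cong : ∀ b k → (b ◂ ρ) k ≡ (b ◂ ρ′) k
  ◂-cong b zero    = refl
  ◂-cong b (suc k) = ρ≗ρ′ k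

⟦⟧-if : ∀ b k k′ ρ → ⟦ if b then tv k else tv k′ ⟧ ρ ≡ (if b then ρ k else ρ k′)
⟦⟧-if true  k k′ ρ = refl
⟦⟧-if false k k′ ρ = refl

shiftVal : ℕ → Valuation → Valuation
shiftVal c ρ k = if k <ᵇ c then ρ k else ρ (suc k)

⟦shift⟧ : ∀ c A ρ → ⟦ shift c A ⟧ ρ ≡ ⟦ A ⟧ (shiftVal c ρ)
⟦shift⟧ c (tv k)  ρ = ⟦⟧-if (k <ᵇ c) k (suc k) ρ
⟦shift⟧ c bot     ρ = refl
⟦shift⟧ c (A ⇒ B) ρ = cong₂ (λ a b → not a ∨ b) (⟦shift⟧ c A ρ) (⟦shift⟧ c B ρ)
⟦shift⟧ c (all A) ρ = cong₂ _∧_ (under true) (under false)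
  where
  shiftVal-◂ : ∀ b k → shiftVal (suc c) (b ◂ ρ) k ≡ (b ◂ shiftVal c ρ) k
  shiftVal-◂ b zero    = refl
  shiftVal-◂ b (suc k) with k <ᵇ c
  ... | true  = refl
  ... | false = refl
  under : ∀ b → ⟦ shift (suc c) A ⟧ (b ◂ ρ) ≡ ⟦ A ⟧ (b ◂ shiftVal c ρ)
  under b = trans (⟦shift⟧ (suc c) A (b ◂ ρ)) (⟦⟧-cong A (shiftVal-◂ b))

⟦shift0⟧ : ∀ A b ρ → ⟦ shift 0 A ⟧ (b ◂ ρ) ≡ ⟦ A ⟧ ρ
⟦shift0⟧ A b ρ = trans (⟦shift⟧ 0 A (b ◂ ρ)) (⟦⟧-cong A (λ _ → refl))

substVal : ℕ → Bool → Valuation → Valuation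
substVal j v ρ k = if k ≡ᵇ j then v else (if k <ᵇ j then ρ k else ρ (pred k))

⟦substTy⟧ : ∀ j B A ρ → ⟦ substTy j B A ⟧ ρ ≡ ⟦ A ⟧ (substVal j (⟦ B ⟧ ρ) ρ)
⟦substTy⟧ j B (tv k) ρ with k ≡ᵇ j
... | true  = refl
... | false = ⟦⟧-if (k <ᵇ j) k (pred k) ρ
⟦substTy⟧ j B bot      ρ = refl
⟦substTy⟧ j B (A ⇒ A′) ρ = cong₂ (λ a b → not a ∨ b) (⟦substTy⟧ j B A ρ) (⟦substTy⟧ j B A′ ρ)
⟦substTy⟧ j B (all A)  ρ = cong₂ _∧_ (under true) (under false)
  where
  substVal-◂ : ∀ b j v k → substVal (suc j) v (b ◂ ρ) k ≡ (b ◂ substVal j v ρ) k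
  substVal-◂ b j       v zero          = refl
  substVal-◂ b zero    v (suc zero)    = refl
  substVal-◂ b zero    v (suc (suc k)) = refl
  substVal-◂ b (suc j) v (suc zero)    = refl
  substVal-◂ b (suc j) v (suc (suc k)) = refl
  under : ∀ b → ⟦ substTy (suc j) (shift 0 B) A ⟧ (b ◂ ρ) ≡ ⟦ A ⟧ (b ◂ substVal j (⟦ B ⟧ ρ) ρ)
  under b = begin
    ⟦ substTy (suc j) (shift 0 B) A ⟧ (b ◂ ρ)           ≡⟨ ⟦substTy⟧ (suc j) (shift 0 B) A (b ◂ ρ) ⟩
    ⟦ A ⟧ (substVal (suc j) (⟦ shift 0 B ⟧ (b ◂ ρ)) (b ◂ ρ)) ≡⟨ cong (λ v → ⟦ A ⟧ (substVal (suc j) v (b ◂ ρ))) (⟦shift0⟧ B b ρ) ⟩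
    ⟦ A ⟧ (substVal (suc j) (⟦ B ⟧ ρ) (b ◂ ρ))            ≡⟨ ⟦⟧-cong A (substVal-◂ b j (⟦ B ⟧ ρ)) ⟩
    ⟦ A ⟧ (b ◂ substVal j (⟦ B ⟧ ρ) ρ)                    ∎
    where open ≡-Reasoning

substVal-zero : ∀ v ρ k → substVal 0 v ρ k ≡ (v ◂ ρ) k
substVal-zero v ρ zero    = refl
substVal-zero v ρ (suc k) = refl

⟦⟧-[] : ∀ A B ρ → ⟦ all A ⟧ ρ ≡ true → ⟦ A [ B ] ⟧ ρ ≡ true
⟦⟧-[] A B ρ valid rewrite ⟦substTy⟧ 0 B A ρ with ⟦ B ⟧ ρ | ⟦ A ⟧ (true ◂ ρ) in valid-true
... | true  | true = trans (⟦⟧-cong A (substVal-zero true ρ)) valid-true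
... | false | true = trans (⟦⟧-cong A (substVal-zero false ρ)) valid

soundness : ∀ {n} {Γ : Vec Ty n} {t A} ρ → Γ ⊢ t ∶ A → (∀ i → ⟦ lookup Γ i ⟧ ρ ≡ true) → ⟦ A ⟧ ρ ≡ true
soundness ρ (ty-var i) valid = valid i
soundness ρ (ty-lam {A} ⊢t) valid with ⟦ A ⟧ ρ in valid-A
... | false = refl
... | true  = soundness ρ ⊢t λ { zero → valid-A ; (suc i) → valid i }
soundness ρ (ty-app {A} ⊢t ⊢u) valid with ⟦ A ⟧ ρ | soundness ρ ⊢t valid | soundness ρ ⊢u valid
... | true | valid-B | _ = valid-B
soundness {Γ = Γ} ρ (ty-gen ⊢t) valid = cong₂ _∧_ (soundness (true ◂ ρ) ⊢t (valid-shifted true)) (soundness (false ◂ ρ) ⊢t (valid-shifted false))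
  where
  valid-shifted : ∀ b i → ⟦ lookup (map (shift 0) Γ) i ⟧ (b ◂ ρ) ≡ true
  valid-shifted b i rewrite lookup-map i (shift 0) Γ | ⟦shift0⟧ (lookup Γ i) b ρ = valid i
soundness ρ (ty-ins {A} B ⊢t) valid = ⟦⟧-[] A B ρ (soundness ρ ⊢t valid)

NotAll : Ty → Set
NotAll (all _) = ⊥
NotAll _       = ⊤

notAll-or-all : ∀ A → NotAll A ⊎ Σ Ty λ B → A ≡ all B
notAll-or-all (tv k)  = inj₁ tt
notAll-or-all bot     = inj₁ tt
notAll-or-all (_ ⇒ _) = inj₁ tt
notAll-or-all (all B) = inj₂ (B , refl)

notAll-shift : ∀ c {A} → NotAll A → NotAll (shift c A)
notAll-shift c {tv k} _ with k <ᵇ c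
... | true  = tt
... | false = tt
notAll-shift c {bot}   _ = tt
notAll-shift c {_ ⇒ _} _ = tt

notAll-shiftN : ∀ m {A} → NotAll A → NotAll (shiftN m A)
notAll-shiftN zero    na = na
notAll-shiftN (suc m) na = notAll-shift 0 (notAll-shiftN m na)

shift-⇒-inv : ∀ c X {A′ C′} → shift c X ≡ A′ ⇒ C′ → Σ Ty λ A → Σ Ty λ C → X ≡ A ⇒ C × A′ ≡ shift c A
shift-⇒-inv c (tv k) eq with k <ᵇ c
shift-⇒-inv c (tv k) () | true
shift-⇒-inv c (tv k) () | false
shift-⇒-inv c (A ⇒ C) refl = A , C , refl , refl

allDepth : Ty → ℕ
allDepth (all A) = suc (allDepth A)
allDepth _       = 0

allDepth-allN : ∀ m {A} → NotAll A → allDepth (allN m A) ≡ m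
allDepth-allN zero {tv _}  _ = refl
allDepth-allN zero {bot}   _ = refl
allDepth-allN zero {_ ⇒ _} _ = refl
allDepth-allN (suc m) na = cong suc (allDepth-allN m na)

-- The m quantifiers in front of shiftN m X bind variables that do not occur in it.
VacuousGen : Ty → Ty → Set
VacuousGen Y X = Σ ℕ λ m → Y ≡ allN m (shiftN m X)

vacuousGen-all : ∀ {X Y} → VacuousGen Y (shift 0 X) → VacuousGen (all Y) X
vacuousGen-all {X} (m , refl) = suc m , cong (λ A → all (allN m A)) (shiftN-shift m X)

vacuousGen-unall : ∀ {X Y} → NotAll X → VacuousGen (all Y) X → VacuousGen Y (shift 0 X)
vacuousGen-unall {X} na (zero , eq) = ⊥-elim (subst NotAll (sym eq) na)
vacuousGen-unall {X} na (suc m , refl) = m , cong (allN m) (sym (shiftN-shift m X))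

vacuousGen-[] : ∀ {X Y} C → NotAll X → VacuousGen (all Y) X → VacuousGen (Y [ C ]) X
vacuousGen-[] C na (zero , eq) = ⊥-elim (subst NotAll (sym eq) na)
vacuousGen-[] {X} C na (suc m , refl) =
  m , trans (allN-[] m C (shiftN (suc m) X)) (cong (allN m) (substTy-shiftN m (shiftN m C) X))

vacuousGen-depth : ∀ {X Y} → NotAll X → VacuousGen Y X → Y ≡ allN (allDepth Y) (shiftN (allDepth Y) X)
vacuousGen-depth {X} na (m , refl) rewrite allDepth-allN m (notAll-shiftN m {X} na) = refl

Rigid : ∀ {n} → Vec Ty n → Tm n → Ty → Set
Rigid Γ t X = ∀ {Y} → Γ ⊢ t ∶ Y → VacuousGen Y X

rigid-shift : ∀ {n} {Γ : Vec Ty n} {t X} → NotAll X → Rigid Γ t X → Rigid (map (shift 0) Γ) t (shift 0 X)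
rigid-shift na R ⊢t = vacuousGen-unall na (R (ty-gen ⊢t))

rigid-var : ∀ {n} {Γ : Vec Ty n} i → NotAll (lookup Γ i) → Rigid Γ (var i) (lookup Γ i)
rigid-var i na (ty-var i) = 0 , refl
rigid-var {Γ = Γ} i na (ty-gen ⊢t) =
  vacuousGen-all (subst (VacuousGen _) (lookup-map i (shift 0) Γ)
    (rigid-var i (subst NotAll (sym (lookup-map i (shift 0) Γ)) (notAll-shift 0 na)) ⊢t))
rigid-var i na (ty-ins C ⊢t) = vacuousGen-[] C na (rigid-var i na ⊢t)

rigid-app : ∀ {n} {Γ : Vec Ty n} {t u A C} → Rigid Γ t (A ⇒ C) → NotAll C → Rigid Γ (app t u) C
rigid-app R na (ty-app ⊢t _) with R ⊢t
... | zero , refl = 0 , refl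
rigid-app R na (ty-gen ⊢t) = vacuousGen-all (rigid-app (rigid-shift tt R) (notAll-shift 0 na) ⊢t)
rigid-app R na (ty-ins C ⊢t) = vacuousGen-[] C na (rigid-app R na ⊢t)

rigid-app-inv : ∀ {n} {Γ : Vec Ty n} {t u X Z} → Rigid Γ t X → NotAll X → Γ ⊢ app t u ∶ Z →
  Σ Ty λ A → Σ Ty λ C → X ≡ A ⇒ C × Γ ⊢ u ∶ A
rigid-app-inv R na (ty-app ⊢t ⊢u) with R ⊢t
... | zero , refl = _ , _ , refl , ⊢u
rigid-app-inv {X = X} R na (ty-gen ⊢t) with rigid-app-inv (rigid-shift na R) (notAll-shift 0 na) ⊢t
... | _ , _ , eq , ⊢u with shift-⇒-inv 0 X eq
... | A , C , refl , refl = A , C , refl , ⊢-unshift ⊢u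
rigid-app-inv R na (ty-ins C ⊢t) = rigid-app-inv R na ⊢t

⊢app-fun : ∀ {n} {Γ : Vec Ty n} {t u Y} → Γ ⊢ app t u ∶ Y → Σ Ty λ Z → Γ ⊢ t ∶ Z
⊢app-fun (ty-app ⊢t _) = _ , ⊢t
⊢app-fun (ty-gen ⊢t) with ⊢app-fun ⊢t
... | Z , ⊢t′ = all Z , ty-gen ⊢t′
⊢app-fun (ty-ins _ ⊢t) = ⊢app-fun ⊢t

data Spine {n} (Γ : Vec Ty n) (h : Tm n) : Ty → Tm n → Ty → Set where
  []  : ∀ {X} → Spine Γ h X h X
  _∷_ : ∀ {u A B t X} → Nf u × Γ ⊢ u ∶ A → Spine Γ (app h u) B t X → Spine Γ h (A ⇒ B) t X

spine-snoc : ∀ {n} {Γ : Vec Ty n} {h H t u A C} → Spine Γ h H t (A ⇒ C) → Nf u × Γ ⊢ u ∶ A → Spine Γ h H (app t u) C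
spine-snoc []       arg = arg ∷ []
spine-snoc (a ∷ sp) arg = a ∷ spine-snoc sp arg

allTrue : Valuation
allTrue _ = true

-- By soundness no argument of type A exists when ⟦ A ⟧ allTrue is false, so a spine headed by a
-- guarded type never reaches a ∀-codomain; here this excludes P in Q ⇒ P.
Guarded : Ty → Set
Guarded (A ⇒ all _) = IsTrue (not (⟦ A ⟧ allTrue))
Guarded (_ ⇒ B)     = Guarded B
Guarded _           = ⊤

-- For a concrete X every field computes to ⊤, so admissibility of a concrete context
-- is proved by `_ ∷ … ∷ []`.
record Admissible (X : Ty) : Set where
  field
    valid   : IsTrue (⟦ X ⟧ allTrue)
    notAll  : NotAll X
    guarded : Guarded X
open Admissible

spine-guarded : ∀ {n} {Γ : Vec Ty n} {h H t A C} → Guarded H → Spine Γ h H t (A ⇒ all C) → IsTrue (not (⟦ A ⟧ allTrue))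
spine-guarded g [] = g
spine-guarded {H = _ ⇒ (_ ⇒ _)} g (_ ∷ sp) = spine-guarded g sp
spine-guarded {H = _ ⇒ tv _}    g (_ ∷ ())
spine-guarded {H = _ ⇒ bot}     g (_ ∷ ())
spine-guarded {H = _ ⇒ all _}   g (_ ∷ ())

admissible-valid : ∀ {n} {Γ : Vec Ty n} {u A} → All Admissible Γ → Γ ⊢ u ∶ A → ⟦ A ⟧ allTrue ≡ true
admissible-valid adm ⊢u = soundness allTrue ⊢u (λ i → Equivalence.to T-≡ (valid (lookup⁺ adm i)))

record HeadSpine {n} (Γ : Vec Ty n) (t : Tm n) : Set where
  constructor headSpine
  field
    head     : Fin n
    {result} : Ty
    spine    : Spine Γ (var head) (lookup Γ head) t result
    result-notAll : NotAll result
    rigid    : Rigid Γ t result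

neutral-headSpine : ∀ {n} {Γ : Vec Ty n} {t Y} → All Admissible Γ → Ne t → Γ ⊢ t ∶ Y → HeadSpine Γ t
neutral-headSpine adm (ne-var i) _ = headSpine i [] na (rigid-var i na)
  where na = notAll (lookup⁺ adm i)
neutral-headSpine adm (ne-app ne nf) ⊢t with ⊢app-fun ⊢t
... | _ , ⊢t′ with neutral-headSpine adm ne ⊢t′
... | headSpine i sp na R with rigid-app-inv R na ⊢t
... | A , C , refl , ⊢u with notAll-or-all C
... | inj₁ naC = headSpine i (spine-snoc sp (nf , ⊢u)) naC (rigid-app R naC)
... | inj₂ (_ , refl) =
  ⊥-elim (subst (λ b → IsTrue (not b)) (admissible-valid adm ⊢u) (spine-guarded (guarded (lookup⁺ adm i)) sp))

-- The exponent is given as allDepth Y rather than existentially, so that once the spine is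
-- matched the equation between concrete types is decided by unification.
data NeutralView {n} (Γ : Vec Ty n) (t : Tm n) (Y : Ty) : Set where
  neutral : ∀ i {X} → Spine Γ (var i) (lookup Γ i) t X → Y ≡ allN (allDepth Y) (shiftN (allDepth Y) X) → NeutralView Γ t Y

neutralView : ∀ {n} {Γ : Vec Ty n} {t Y} → All Admissible Γ → Ne t → Γ ⊢ t ∶ Y → NeutralView Γ t Y
neutralView adm ne ⊢t with neutral-headSpine adm ne ⊢t
... | headSpine i sp na R = neutral i sp (vacuousGen-depth na (R ⊢t))

-- The contexts met while descending into λx λy (x u₁ u₂): the name lists the bound variables
-- in binding order (a, b : Y bound by B; z : Q ⇒ P, a : Y, f : Y ⇒ Y bound by D), so the last
-- one is de Bruijn index 0.
Γx : Vec Ty 1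
Γx = (Bty ⇒ Dty ⇒ tv 0) ∷ []

Γxy : Vec Ty 2
Γxy = tv 0 ∷ Γx

Γxya : Vec Ty 3
Γxya = tv 0 ∷ map (shift 0) Γxy

Γxyab : Vec Ty 4
Γxyab = tv 0 ∷ Γxya

Γxyz : Vec Ty 3
Γxyz = (Qty ⇒ Pty) ∷ Γxy

Γxyza : Vec Ty 4
Γxyza = tv 0 ∷ map (shift 0) Γxyz

Γxyzaf : Vec Ty 5
Γxyzaf = (tv 0 ⇒ tv 0) ∷ Γxyza

¬ne-Γx : ∀ {t} → Ne t → Γx ⊢ t ∶ tv 0 ⇒ tv 0 → ⊥
¬ne-Γx ne ⊢t with neutralView (_ ∷ []) ne ⊢t
... | neutral zero [] ()
... | neutral zero (_ ∷ []) ()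
... | neutral zero (_ ∷ _ ∷ []) ()

atom-Γxy : ∀ {t} → Nf t → Γxy ⊢ t ∶ tv 0 →
  t ≡ var zero ⊎ Σ (Tm 2) λ u₁ → Σ (Tm 2) λ u₂ →
    t ≡ app (app (var (suc zero)) u₁) u₂ × (Nf u₁ × Γxy ⊢ u₁ ∶ Bty) × (Nf u₂ × Γxy ⊢ u₂ ∶ Dty)
atom-Γxy (nf-lam _) ⊢t = ⊥-elim (⊢lam-tv ⊢t)
atom-Γxy (nf-ne ne) ⊢t with neutralView (_ ∷ _ ∷ []) ne ⊢t
... | neutral zero [] refl = inj₁ refl
... | neutral (suc zero) (arg₁ ∷ arg₂ ∷ []) refl = inj₂ (_ , _ , refl , arg₁ , arg₂)
... | neutral (suc zero) [] ()
... | neutral (suc zero) (_ ∷ []) ()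

¬ne-Γxy-B : ∀ {t} → Ne t → Γxy ⊢ t ∶ Bty → ⊥
¬ne-Γxy-B ne ⊢t with neutralView (_ ∷ _ ∷ []) ne ⊢t
... | neutral zero [] ()
... | neutral (suc zero) [] ()
... | neutral (suc zero) (_ ∷ []) ()
... | neutral (suc zero) (_ ∷ _ ∷ []) ()

¬ne-Γxya : ∀ {t} → Ne t → Γxya ⊢ t ∶ tv 0 ⇒ tv 0 → ⊥
¬ne-Γxya ne ⊢t with neutralView (_ ∷ _ ∷ _ ∷ []) ne ⊢t
... | neutral zero [] ()
... | neutral (suc zero) [] ()
... | neutral (suc (suc zero)) [] ()
... | neutral (suc (suc zero)) (_ ∷ []) ()
... | neutral (suc (suc zero)) (_ ∷ _ ∷ []) ()

atom-Γxyab : ∀ {t} → Nf t → Γxyab ⊢ t ∶ tv 0 → t ≡ var zero ⊎ t ≡ var (suc zero)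
atom-Γxyab (nf-lam _) ⊢t = ⊥-elim (⊢lam-tv ⊢t)
atom-Γxyab (nf-ne ne) ⊢t with neutralView (_ ∷ _ ∷ _ ∷ _ ∷ []) ne ⊢t
... | neutral zero [] refl = inj₁ refl
... | neutral (suc zero) [] refl = inj₂ refl
... | neutral (suc (suc zero)) [] ()
... | neutral (suc (suc (suc zero))) [] ()
... | neutral (suc (suc (suc zero))) (_ ∷ []) ()
... | neutral (suc (suc (suc zero))) (_ ∷ _ ∷ []) ()

B-inhabitants : ∀ {u} → Nf u → Γxy ⊢ u ∶ Bty → Σ (Tm 0) λ b → (b ≡ T ⊎ b ≡ F) × u ≡ wk (wk b)
B-inhabitants (nf-ne ne) ⊢u = ⊥-elim (¬ne-Γxy-B ne ⊢u)
B-inhabitants (nf-lam (nf-ne ne)) ⊢u = ⊥-elim (¬ne-Γxya ne (⊢lam-∀⇒-inv ⊢u))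
B-inhabitants (nf-lam (nf-lam nf)) ⊢u with atom-Γxyab nf (⊢lam-⇒-inv (⊢lam-∀⇒-inv ⊢u))
... | inj₁ refl = F , inj₂ refl , refl
... | inj₂ refl = T , inj₁ refl , refl

¬ne-Γxy-D : ∀ {t} → Ne t → Γxy ⊢ t ∶ Dty → ⊥
¬ne-Γxy-D ne ⊢t with neutralView (_ ∷ _ ∷ []) ne ⊢t
... | neutral zero [] ()
... | neutral (suc zero) [] ()
... | neutral (suc zero) (_ ∷ []) ()
... | neutral (suc zero) (_ ∷ _ ∷ []) ()

¬ne-Γxyz : ∀ {t} → Ne t → Γxyz ⊢ t ∶ Nty → ⊥
¬ne-Γxyz ne ⊢t with neutralView (_ ∷ _ ∷ _ ∷ []) ne ⊢t
... | neutral zero [] ()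
... | neutral zero (_ ∷ []) ()
... | neutral (suc zero) [] ()
... | neutral (suc (suc zero)) [] ()
... | neutral (suc (suc zero)) (_ ∷ []) ()
... | neutral (suc (suc zero)) (_ ∷ _ ∷ []) ()

¬ne-Γxyza : ∀ {t} → Ne t → Γxyza ⊢ t ∶ (tv 0 ⇒ tv 0) ⇒ tv 0 → ⊥
¬ne-Γxyza ne ⊢t with neutralView (_ ∷ _ ∷ _ ∷ _ ∷ []) ne ⊢t
... | neutral zero [] ()
... | neutral (suc zero) [] ()
... | neutral (suc zero) (_ ∷ []) ()
... | neutral (suc (suc zero)) [] ()
... | neutral (suc (suc (suc zero))) [] ()
... | neutral (suc (suc (suc zero))) (_ ∷ []) ()
... | neutral (suc (suc (suc zero))) (_ ∷ _ ∷ []) ()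

atom-Γxyzaf : ∀ {t} → Nf t → Γxyzaf ⊢ t ∶ tv 0 → Σ ℕ λ k → t ≡ iterBody k
atom-Γxyzaf (nf-lam _) ⊢t = ⊥-elim (⊢lam-tv ⊢t)
atom-Γxyzaf (nf-ne ne) ⊢t with neutralView (_ ∷ _ ∷ _ ∷ _ ∷ _ ∷ []) ne ⊢t
... | neutral zero [] ()
... | neutral (suc zero) [] refl = 0 , refl
... | neutral (suc (suc zero)) [] ()
... | neutral (suc (suc zero)) (_ ∷ []) ()
... | neutral (suc (suc (suc zero))) [] ()
... | neutral (suc (suc (suc (suc zero)))) [] ()
... | neutral (suc (suc (suc (suc zero)))) (_ ∷ []) ()
... | neutral (suc (suc (suc (suc zero)))) (_ ∷ _ ∷ []) ()
... | neutral zero ((nf , ⊢t′) ∷ []) refl with atom-Γxyzaf nf ⊢t′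
...   | k , refl = suc k , refl

rename-iterBody : ∀ {m m′} (ρ : Fin m → Fin m′) k → rename (ext (ext ρ)) (iterBody k) ≡ iterBody k
rename-iterBody ρ zero    = refl
rename-iterBody ρ (suc k) = cong (app (var zero)) (rename-iterBody ρ k)

wk-wk-d : ∀ k → wk (wk (d k)) ≡ lam (church k)
wk-wk-d k = cong (λ s → lam (lam (lam s)))
  (trans (cong (rename (ext (ext (ext suc)))) (rename-iterBody (ext suc) k)) (rename-iterBody (ext suc) k))

D-inhabitants : ∀ {u} → Nf u → Γxy ⊢ u ∶ Dty → Σ ℕ λ k → u ≡ wk (wk (d k))
D-inhabitants (nf-ne ne) ⊢u = ⊥-elim (¬ne-Γxy-D ne ⊢u)
D-inhabitants (nf-lam (nf-ne ne)) ⊢u = ⊥-elim (¬ne-Γxyz ne (⊢lam-⇒-inv ⊢u))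
D-inhabitants (nf-lam (nf-lam (nf-ne ne))) ⊢u = ⊥-elim (¬ne-Γxyza ne (⊢lam-∀⇒-inv (⊢lam-⇒-inv ⊢u)))
D-inhabitants (nf-lam (nf-lam (nf-lam nf))) ⊢u with atom-Γxyzaf nf (⊢lam-⇒-inv (⊢lam-∀⇒-inv (⊢lam-⇒-inv ⊢u)))
... | k , refl = k , sym (wk-wk-d k)

¬ne-closed : ∀ {t : Tm 0} → Ne t → ⊥
¬ne-closed (ne-app ne _) = ¬ne-closed ne

ECanonical : Tm 0 → Set
ECanonical t = t ≡ F ⊎ Σ ℕ (λ n → Σ (Tm 0) (λ b → (b ≡ T ⊎ b ≡ F) × t ≡ ⟪ b , d n ⟫))

E-inhabitants : ∀ {t} → Nf t → [] ⊢ t ∶ Ety → ECanonical t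
E-inhabitants (nf-ne ne) _ = ⊥-elim (¬ne-closed ne)
E-inhabitants (nf-lam (nf-ne ne)) ⊢t = ⊥-elim (¬ne-Γx ne (⊢lam-∀⇒-inv ⊢t))
E-inhabitants (nf-lam (nf-lam nf)) ⊢t with atom-Γxy nf (⊢lam-⇒-inv (⊢lam-∀⇒-inv ⊢t))
... | inj₁ refl = inj₁ refl
... | inj₂ (_ , _ , refl , (nf₁ , ⊢u₁) , (nf₂ , ⊢u₂)) with B-inhabitants nf₁ ⊢u₁ | D-inhabitants nf₂ ⊢u₂
... | b , isBool , refl | k , refl = inj₂ (k , b , isBool , refl)

⊢iterBody : ∀ {m} {Γ : Vec Ty m} k → ((tv 0 ⇒ tv 0) ∷ tv 0 ∷ Γ) ⊢ iterBody k ∶ tv 0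
⊢iterBody zero    = ty-var (suc zero)
⊢iterBody (suc k) = ty-app (ty-var zero) (⊢iterBody k)

⊢d : ∀ {m} {Γ : Vec Ty m} k → Γ ⊢ lam (church k) ∶ Dty
⊢d k = ty-lam (ty-gen (ty-lam (ty-lam (⊢iterBody k))))

⊢Bool : ∀ {b} → b ≡ T ⊎ b ≡ F → Γxy ⊢ wk (wk b) ∶ Bty
⊢Bool (inj₁ refl) = ty-gen (ty-lam (ty-lam (ty-var (suc zero))))
⊢Bool (inj₂ refl) = ty-gen (ty-lam (ty-lam (ty-var zero)))

E-canonical-typable : ∀ {t} → ECanonical t → [] ⊢ t ∶ Ety
E-canonical-typable (inj₁ refl) = ty-gen (ty-lam (ty-lam (ty-var zero)))
E-canonical-typable (inj₂ (k , b , isBool , refl)) =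
  ty-gen (ty-lam (ty-lam (ty-app (ty-app (ty-var (suc zero)) (⊢Bool isBool))
    (subst (Γxy ⊢_∶ Dty) (sym (wk-wk-d k)) (⊢d k)))))

mainTheorem9 : (t : Tm 0) → Nf t →
    (([] ⊢ t ∶ Ety) ⇔
     (t ≡ F ⊎ Σ ℕ (λ n → Σ (Tm 0) (λ b → (b ≡ T ⊎ b ≡ F) × t ≡ ⟪ b , d n ⟫))))
mainTheorem9 t nf = mk⇔ (E-inhabitants nf) E-canonical-typable
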